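{- Let $G$ be an ordered graph with $n$ vertices and $m$ edges. For every integer $r\ge1$, the total number of edges of all graphs in $\mathcal G_r(G)$ is at most $m$. Consequently, for every $r\ge1$, $\mathcal G_r(G)$ contains at most $4mn$ graphs.
   Context: An ordered graph is a finite simple graph with a linear order on its vertices. It is monotone bipartite if its vertex set splits as $X\cup Y$ with every vertex of $X$ before every vertex of $Y$ and every edge joining $X$ to $Y$ (edgeless graphs included). Canonical delayed decomposition of an ordered graph $(G,<)$, $V=V(G)$: build a rooted tree $T$ top-down, assigning to each node $x$ an interval $L(x)$ of $(V,<)$; the root has $L=V$. For a node $x$: (i) if $|L(x)|=1$, $x$ gets one child, a leaf identified with the vertex of $L(x)$; (ii) if $|L(x)|\ge2$ and $L(x)$ is a module (each vertex outside $L(x)$ is adjacent to all or none of $L(x)$), $x$ gets two children $y_1,y_2$ with $L(y_1)=\{u\}$, $u$ the minimum of $L(x)$, and $L(y_2)=L(x)\setminus\{u\}$; (iii) otherwise, with $u_1\sim u_2$ iff every $w$ in the interval between $u_1,u_2$ has the same neighbourhood in $V\setminus L(x)$ as $u_1$ and $u_2$, the classes of $\sim$ are intervals $I_1<\dots<I_k$ and $x$ gets children $y_1,\dots,y_k$ with $L(y_i)=I_i$. Nodes not in ancestor–descendant relation are ordered by $x<y$ iff $L(x)<L(y)$. For each node $x$, the quotient graph $G_x$ is the ordered graph on the grandchildren of $x$ (ordered by $<$) in which two non-sibling grandchildren $y,y'$ are adjacent iff $G$ has an edge between $L(y)$ and $L(y')$ (siblings non-adjacent). Labels: nodes without grandparent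 get label $\emptyset$; otherwise $x$ (with grandparent $p^2(x)$; cousins = non-sibling nodes with same grandparent) gets $R$ if some cousin $x'>x$ has $xx'\in E(G_{p^2(x)})$, else $L$ if some cousin $x'<x$ has $xx'\in E(G_{p^2(x)})$, else $O$. If a node $y$ labelled $O$ is not the first child of its parent and its parent has at least $3$ children, its label is refined to $O_L$ (resp. $O_R$) if its immediately preceding sibling is labelled $L$ (resp. $R$). The type of a node is the label of its parent. Refined quotient graphs of $(G,<)$ (defined when $(G,<)$ is not monotone bipartite; a monotone bipartite graph has none): take the canonical delayed decomposition. For each quotient graph $G_x$: if $G_x$ is monotone bipartite, $G_x$ is a refined quotient graph. Otherwise, if the first child of $x$ is labelled $O$, delete its children from $G_x$; every remaining vertex has type $R$, $L$, $O_R$ or $O_L$; put $R'=\{R,O_R\}$, $L'=\{L,O_L\}$, and classify each edge by whether the type of its left endpoint is in $R'$ or $L'$ and likewise for its right endpoint (classes $R'R',R'L',L'R',L'L'$). Four refined quotient graphs arise: the graph on the remaining vertices with the $R'R'$ edges, minus all vertices before the first and after the last vertex of type $R$; with the $R'L'$ edges, minus vertices before the first and after the last vertex of type $L$; with the $L'R'$ edges, minus vertices before the first and after the last vertex of type $R$; with the $L'L'$ edges, minus vertices before the first and after the last vertex of type $L$. $\mathcal G_0(G)=\{G\}$ and $\mathcal G_{i+1}(G)$ is the collection (counted with multiplicity) of all refined quotient graphs of all members of $\mathcal G_i(G)$. -}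

module Defs where

open import Data.Bool using (Bool; true; false; if_then_else_; _∧_; _∨_; not)
open import Data.Nat using (ℕ; zero; suc; _+_; _∸_; _≡ᵇ_; _<ᵇ_; _≤ᵇ_)
open import Data.List using (List; []; _∷_; _++_; map; concat; length; upTo; zipWith; reverse)
open import Data.Bool.ListAction using (any; all)
open import Data.Maybe using (Maybe; just; nothing)
open import Data.Product using (_×_; _,_; proj₁; proj₂)

-- An ordered graph on the vertex set {0,…,size-1}, ordered by the
-- natural order of ℕ.  Its edge set is { {i,j} : i < j < size, E i j ≡ true }.
-- (Values of E outside of i < j < size are irrelevant.)  Every finite
-- simple ordered graph is (up to order isomorphism) of this form.

record OGraph : Set where
  constructor mkOGraph
  field
    size : ℕ
    E    : ℕ → ℕ → Bool
open OGraph public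

adj : OGraph → ℕ → ℕ → Bool
adj G u v = ((u <ᵇ v) ∧ E G u v) ∨ ((v <ᵇ u) ∧ E G v u)

filterB : {A : Set} → (A → Bool) → List A → List A
filterB p [] = []
filterB p (x ∷ xs) = if p x then x ∷ filterB p xs else filterB p xs

dropWhileB : {A : Set} → (A → Bool) → List A → List A
dropWhileB p [] = []
dropWhileB p (x ∷ xs) = if p x then dropWhileB p xs else x ∷ xs

at : {A : Set} → A → List A → ℕ → A
at d [] _ = d
at d (x ∷ xs) zero = x
at d (x ∷ xs) (suc i) = at d xs i

range : ℕ → ℕ → List ℕ
range lo len = map (lo +_) (upTo len)

edges : OGraph → ℕ
edges G = length (concat (map (λ i → filterB (λ j → (i <ᵇ j) ∧ E G i j) (upTo (size G))) (upTo (size G))))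

-- monotone bipartite: there is a cut s (X = [0,s), Y = [s,size))
-- such that every edge joins X to Y
isMB : OGraph → Bool
isMB G = any (λ s → all (λ i → all (λ j → not ((i <ᵇ j) ∧ E G i j) ∨ ((i <ᵇ s) ∧ (s ≤ᵇ j)))
                                   (upTo (size G))) (upTo (size G))) (upTo (suc (size G)))

-- ordered graph built from an ordered list of vertex data and an
-- edge predicate (applied to the left endpoint, then the right one)
mkGraph : {A : Set} → A → List A → (A → A → Bool) → OGraph
mkGraph d vs P = mkOGraph (length vs) (λ i j → P (at d vs i) (at d vs j))

-- Canonical delayed decomposition of G.
-- A node carries its interval L(x) = [lo, lo+len); leaves carry a vertex.

data Tree : Set where
  leaf : ℕ → Tree
  node : ℕ → ℕ → List Tree → Tree

ival : Tree → ℕ × ℕ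
ival (leaf v) = v , 1
ival (node lo len _) = lo , len

children : Tree → List Tree
children (leaf _) = []
children (node _ _ cs) = cs

module Decomp (G : OGraph) where

  outside : ℕ → ℕ → List ℕ
  outside lo len = filterB (λ w → (w <ᵇ lo) ∨ ((lo + len) ≤ᵇ w)) (upTo (size G))

  isModule : ℕ → ℕ → Bool
  isModule lo len = all (λ w → all (λ u → adj G u w) (range lo len)
                              ∨ all (λ u → not (adj G u w)) (range lo len))
                        (outside lo len)

  sameOut : ℕ → ℕ → ℕ → ℕ → Bool
  sameOut lo len u v = all (λ w → (adj G u w ∧ adj G v w) ∨ (not (adj G u w) ∧ not (adj G v w)))
                           (outside lo len)

  intervalsFrom : List ℕ → ℕ → List (ℕ × ℕ)
  intervalsFrom [] end = []
  intervalsFrom (s ∷ []) end = (s , end ∸ s) ∷ []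
  intervalsFrom (s ∷ t ∷ rest) end = (s , t ∸ s) ∷ intervalsFrom (t ∷ rest) end

  -- classes of ∼ : maximal runs of consecutive vertices with equal
  -- neighbourhood outside [lo,lo+len)
  classes : ℕ → ℕ → List (ℕ × ℕ)
  classes lo len =
    intervalsFrom (lo ∷ filterB (λ u → not (sameOut lo len (u ∸ 1) u)) (range (suc lo) (len ∸ 1)))
                  (lo + len)

  -- build fuel lo len: the subtree rooted at the node with L = [lo,lo+len).
  -- Children have strictly smaller intervals, so fuel = len never runs out.
  build : ℕ → ℕ → ℕ → Tree
  build zero lo len = node lo len []
  build (suc f) lo zero = node lo zero []
  build (suc f) lo (suc zero) = node lo 1 (leaf lo ∷ [])
  build (suc f) lo (suc (suc k)) =
    if isModule lo (suc (suc k))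
    then node lo (suc (suc k)) (build f lo 1 ∷ build f (suc lo) (suc k) ∷ [])
    else node lo (suc (suc k)) (map (λ p → build f (proj₁ p) (proj₂ p)) (classes lo (suc (suc k))))

  tree : Tree
  tree = build (size G) 0 (size G)

  edgeBetween : ℕ × ℕ → ℕ × ℕ → Bool
  edgeBetween (a , la) (b , lb) = any (λ u → any (λ v → adj G u v) (range b lb)) (range a la)

data Label : Set where
  ∅ Lr Ll O Or Ol : Label

isR isL isO inR' inL' : Label → Bool
isR Lr = true
isR _ = false
isL Ll = true
isL _ = false
isO O = true
isO _ = false
inR' Lr = true
inR' Or = true
inR' _ = false
inL' Ll = true
inL' Ol = true
inL' _ = false

refineAux : Maybe Label → List Label → List Label
refineAux prev [] = []
refineAux prev (O ∷ ls) with prev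
... | just Ll = Ol ∷ refineAux (just O) ls
... | just Lr = Or ∷ refineAux (just O) ls
... | _ = O ∷ refineAux (just O) ls
refineAux prev (l ∷ ls) = l ∷ refineAux (just l) ls

refine : List Label → List Label
refine ls = if 3 ≤ᵇ length ls then refineAux nothing ls else ls

-- a vertex of a quotient graph: (index of its parent among the children
-- of x , type , interval L)
QV : Set
QV = ℕ × Label × (ℕ × ℕ)

pidx : QV → ℕ
pidx = proj₁
typ : QV → Label
typ v = proj₁ (proj₂ v)
qiv : QV → ℕ × ℕ
qiv v = proj₂ (proj₂ v)

dQV : QV
dQV = 0 , ∅ , (0 , 0)

trim : (QV → Bool) → List QV → List QV
trim p vs = reverse (dropWhileB (λ v → not (p v)) (reverse (dropWhileB (λ v → not (p v)) vs)))

module Refined (G : OGraph) where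
  open Decomp G

  -- cousin context of the children of x: `nothing` if x is the root,
  -- otherwise `just` the intervals of the grandchildren of p(x) not
  -- below x.
  baseLabel : Maybe (List (ℕ × ℕ)) → Tree → Label
  baseLabel nothing c = ∅
  baseLabel (just cous) c =
    if any (λ c' → (proj₁ (ival c) <ᵇ proj₁ c') ∧ edgeBetween (ival c) c') cous then Lr
    else if any (λ c' → (proj₁ c' <ᵇ proj₁ (ival c)) ∧ edgeBetween (ival c) c') cous then Ll
    else O

  refinedAt : Maybe (List (ℕ × ℕ)) → Tree → List OGraph
  refinedAt ctx x = if isMB Gx then Gx ∷ [] else
      ( mkGraph dQV (trim (λ v → isR (typ v)) vs')
          (λ a b → inR' (typ a) ∧ inR' (typ b) ∧ qadj a b)
      ∷ mkGraph dQV (trim (λ v → isL (typ v)) vs')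
          (λ a b → inR' (typ a) ∧ inL' (typ b) ∧ qadj a b)
      ∷ mkGraph dQV (trim (λ v → isR (typ v)) vs')
          (λ a b → inL' (typ a) ∧ inR' (typ b) ∧ qadj a b)
      ∷ mkGraph dQV (trim (λ v → isL (typ v)) vs')
          (λ a b → inL' (typ a) ∧ inL' (typ b) ∧ qadj a b)
      ∷ [])
    where
      cs : List Tree
      cs = children x
      labs : List Label
      labs = refine (map (baseLabel ctx) cs)
      vs : List QV
      vs = concat (zipWith (λ j p → map (λ g → j , proj₂ p , ival g) (children (proj₁ p)))
                           (upTo (length cs)) (zipWith _,_ cs labs))
      qadj : QV → QV → Bool
      qadj a b = not (pidx a ≡ᵇ pidx b) ∧ edgeBetween (qiv a) (qiv b)
      Gx : OGraph
      Gx = mkGraph dQV vs qadj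
      vs' : List QV
      vs' = if isO (at ∅ labs 0) then filterB (λ v → not (pidx v ≡ᵇ 0)) vs else vs

  cousinIntervals : List Tree → ℕ → List (ℕ × ℕ)
  cousinIntervals cs i =
    concat (zipWith (λ j c → if j ≡ᵇ i then [] else map ival (children c)) (upTo (length cs)) cs)

  mutual
    allRefined : Maybe (List (ℕ × ℕ)) → Tree → List OGraph
    allRefined ctx (leaf v) = refinedAt ctx (leaf v)
    allRefined ctx (node lo len cs) = refinedAt ctx (node lo len cs) ++ goCs cs 0 cs

    goCs : List Tree → ℕ → List Tree → List OGraph
    goCs cs i [] = []
    goCs cs i (c ∷ rest) = allRefined (just (cousinIntervals cs i)) c ++ goCs cs (suc i) rest

  refinedQuotients : List OGraph
  refinedQuotients = if isMB G then [] else allRefined nothing tree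

-- 𝒢_i(G), as a list (multiplicities retained)
𝒢 : ℕ → OGraph → List OGraph
𝒢 zero G = G ∷ []
𝒢 (suc i) G = concat (map (λ H → Refined.refinedQuotients H) (𝒢 i G))

module Submission where

-- Every refined quotient graph of G arises at a node x of the canonical delayed decomposition
-- and its edges are edges of the quotient graph G_x, each witnessed by an edge of G between two
-- different children of x.  Witnesses at different nodes are different, so one round of
-- refinement does not increase the total number of edges, which gives the first bound for all r.
-- A node contributes one graph when G_x is monotone bipartite and four otherwise, and then G_x
-- has at least two edges; since a split node has at least two children, the refined quotient
-- graphs of a graph with n vertices and m ≥ 2 edges number at most 3n + 2m ≤ 4mn.  All graphs
-- in 𝒢_r(G) have at most n vertices, so summing over 𝒢_(r-1)(G) gives the second bound.

open import Defs
open import Data.Bool using (Bool; true; false; if_then_else_; _∧_; _∨_; not)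
open import Data.Bool.Properties using (T-≡; ∨-identityʳ; ∨-zeroʳ)
open import Function.Bundles using (Equivalence)
open import Data.Nat using (ℕ; zero; suc; _+_; _∸_; _*_; _<_; _≤_; _≟_; _≡ᵇ_; _<ᵇ_; _≤ᵇ_; z≤n; s≤s)
open import Data.Nat.Properties
open import Data.Nat.ListAction using (sum)
open import Data.Nat.ListAction.Properties using (sum-++)
open import Data.Nat.Tactic.RingSolver using (solve-∀)
open import Data.List using (List; []; _∷_; _++_; map; concat; concatMap; length; upTo; applyUpTo; zipWith; reverse)
open import Data.List.Properties using (map-++; map-∘; map-id; map-cong-local; length-map; length-++; concatMap-++; reverse-involutive)
open import Data.List.Membership.Propositional using (_∈_)
open import Data.List.Membership.Propositional.Properties using (∈-upTo⁺; ∈-upTo⁻)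
open import Data.List.Relation.Unary.Any using (here; there)
open import Data.List.Relation.Unary.All as All using (All; []; _∷_)
import Data.List.Relation.Unary.All.Properties as All
open import Data.List.Relation.Binary.Sublist.Propositional using (_⊆_; []; _∷_; _∷ʳ_; ⊆-refl; ⊆-reflexive; ⊆-trans; minimum)
open import Data.List.Relation.Binary.Sublist.Propositional.Properties using (reverse⁺; ++⁺; length-mono-≤)
open import Data.Bool.ListAction using (any; all)
open import Data.Maybe using (just; nothing)
open import Data.Product using (∃-syntax; _×_; _,_; proj₁; proj₂)
open import Data.Sum using (inj₁; inj₂)
open import Data.Empty using (⊥; ⊥-elim)
open import Function using (_∘_)
open import Relation.Nullary using (Dec; yes; no)
open import Relation.Binary.PropositionalEquality
import Algebra.Properties.CommutativeSemigroup as CommSemigroupProperties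

⟦_⟧ : Bool → ℕ
⟦ true ⟧ = 1
⟦ false ⟧ = 0

⟦⟧-true : ∀ {b} → b ≡ true → 1 ≤ ⟦ b ⟧
⟦⟧-true refl = s≤s z≤n

⟦∧⟧-≤ʳ : ∀ a b → ⟦ a ∧ b ⟧ ≤ ⟦ b ⟧
⟦∧⟧-≤ʳ true b = ≤-refl
⟦∧⟧-≤ʳ false b = z≤n

∑ : {A : Set} → (A → ℕ) → List A → ℕ
∑ f xs = sum (map f xs)

module _ {A : Set} where

  ∑-++ : (f : A → ℕ) (xs ys : List A) → ∑ f (xs ++ ys) ≡ ∑ f xs + ∑ f ys
  ∑-++ f xs ys = trans (cong sum (map-++ f xs ys)) (sum-++ (map f xs) (map f ys))

  ∑-concat : (f : A → ℕ) (xss : List (List A)) → ∑ f (concat xss) ≡ ∑ (∑ f) xss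
  ∑-concat f [] = refl
  ∑-concat f (xs ∷ xss) = trans (∑-++ f xs (concat xss)) (cong (∑ f xs +_) (∑-concat f xss))

  ∑-+ : (f g : A → ℕ) (xs : List A) → ∑ (λ x → f x + g x) xs ≡ ∑ f xs + ∑ g xs
  ∑-+ f g [] = refl
  ∑-+ f g (x ∷ xs) = trans (cong (f x + g x +_) (∑-+ f g xs)) (+-interchange (f x) (g x) _ _)
    where +-interchange = CommSemigroupProperties.interchange +-commutativeSemigroup

  ∑-*ˡ : (k : ℕ) (f : A → ℕ) (xs : List A) → ∑ (λ x → k * f x) xs ≡ k * ∑ f xs
  ∑-*ˡ k f [] = sym (*-zeroʳ k)
  ∑-*ˡ k f (x ∷ xs) = trans (cong (k * f x +_) (∑-*ˡ k f xs)) (sym (*-distribˡ-+ k (f x) (∑ f xs)))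

  ∑-zero : (xs : List A) → ∑ (λ _ → 0) xs ≡ 0
  ∑-zero [] = refl
  ∑-zero (x ∷ xs) = ∑-zero xs

  ∑-mono : {f g : A → ℕ} (xs : List A) → (∀ x → f x ≤ g x) → ∑ f xs ≤ ∑ g xs
  ∑-mono [] f≤g = z≤n
  ∑-mono (x ∷ xs) f≤g = +-mono-≤ (f≤g x) (∑-mono xs f≤g)

  ∑-mono-All : {f g : A → ℕ} {xs : List A} → All (λ x → f x ≤ g x) xs → ∑ f xs ≤ ∑ g xs
  ∑-mono-All [] = z≤n
  ∑-mono-All (p ∷ ps) = +-mono-≤ p (∑-mono-All ps)

  ∑-cong-∈ : {f g : A → ℕ} (xs : List A) → (∀ {x} → x ∈ xs → f x ≡ g x) → ∑ f xs ≡ ∑ g xs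
  ∑-cong-∈ [] f≡g = refl
  ∑-cong-∈ (x ∷ xs) f≡g = cong₂ _+_ (f≡g (here refl)) (∑-cong-∈ xs (f≡g ∘ there))

  ∑-⊆ : (f : A → ℕ) {xs ys : List A} → xs ⊆ ys → ∑ f xs ≤ ∑ f ys
  ∑-⊆ f [] = z≤n
  ∑-⊆ f (y ∷ʳ p) = ≤-trans (∑-⊆ f p) (m≤n+m _ (f y))
  ∑-⊆ f (refl ∷ p) = +-monoʳ-≤ _ (∑-⊆ f p)

  ∑-∈ : (f : A → ℕ) {x : A} {xs : List A} → x ∈ xs → f x ≤ ∑ f xs
  ∑-∈ f (here refl) = m≤m+n _ _
  ∑-∈ f {xs = y ∷ ys} (there x∈ys) = ≤-trans (∑-∈ f x∈ys) (m≤n+m _ (f y))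

  ∑-∈₂ : (f : A → ℕ) {x y : A} {xs : List A} → x ∈ xs → y ∈ xs → x ≢ y → f x + f y ≤ ∑ f xs
  ∑-∈₂ f (here refl) (here refl) x≢y = ⊥-elim (x≢y refl)
  ∑-∈₂ f (here refl) (there y∈xs) x≢y = +-monoʳ-≤ _ (∑-∈ f y∈xs)
  ∑-∈₂ f {x} {y} {_ ∷ xs} (there x∈xs) (here refl) x≢y =
    subst (_≤ f y + ∑ f xs) (+-comm (f y) (f x)) (+-monoʳ-≤ (f y) (∑-∈ f x∈xs))
  ∑-∈₂ f {xs = z ∷ _} (there x∈xs) (there y∈xs) x≢y = ≤-trans (∑-∈₂ f x∈xs y∈xs x≢y) (m≤n+m _ (f z))

∑-map : {A B : Set} (f : B → ℕ) (g : A → B) (xs : List A) → ∑ f (map g xs) ≡ ∑ (f ∘ g) xs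
∑-map f g xs = cong sum (sym (map-∘ xs))

∑-swap : {A B : Set} (h : A → B → ℕ) (xs : List A) (ys : List B) →
         ∑ (λ x → ∑ (h x) ys) xs ≡ ∑ (λ y → ∑ (λ x → h x y) xs) ys
∑-swap h [] ys = sym (∑-zero ys)
∑-swap h (x ∷ xs) ys = trans (cong (∑ (h x) ys +_) (∑-swap h xs ys))
                             (sym (∑-+ (h x) (λ y → ∑ (λ x' → h x' y) xs) ys))
module _ {A : Set} where

  pairSum : (A → A → ℕ) → List A → ℕ
  pairSum w [] = 0
  pairSum w (x ∷ xs) = ∑ (w x) xs + pairSum w xs

  crossSum : (A → A → ℕ) → List A → List A → ℕ
  crossSum w xs ys = ∑ (λ x → ∑ (w x) ys) xs

  ⟪_⟫ : (A → A → Bool) → A → A → ℕ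
  ⟪ P ⟫ a b = ⟦ P a b ⟧

  pairSum-++ : (w : A → A → ℕ) (xs ys : List A) →
               pairSum w (xs ++ ys) ≡ pairSum w xs + pairSum w ys + crossSum w xs ys
  pairSum-++ w [] ys = sym (+-identityʳ _)
  pairSum-++ w (x ∷ xs) ys
    rewrite pairSum-++ w xs ys | ∑-++ (w x) xs ys =
      regroup (∑ (w x) xs) (∑ (w x) ys) (pairSum w xs) (pairSum w ys) (crossSum w xs ys)
    where regroup : ∀ a b c d e → a + b + (c + d + e) ≡ a + c + d + (b + e)
          regroup = solve-∀

  pairSum-+ : (v w : A → A → ℕ) (xs : List A) →
              pairSum (λ a b → v a b + w a b) xs ≡ pairSum v xs + pairSum w xs
  pairSum-+ v w [] = refl
  pairSum-+ v w (x ∷ xs) rewrite ∑-+ (v x) (w x) xs | pairSum-+ v w xs =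
    regroup (∑ (v x) xs) (∑ (w x) xs) (pairSum v xs) (pairSum w xs)
    where regroup : ∀ a b c d → a + b + (c + d) ≡ a + c + (b + d)
          regroup = solve-∀

  pairSum-mono : {v w : A → A → ℕ} (xs : List A) → (∀ a b → v a b ≤ w a b) → pairSum v xs ≤ pairSum w xs
  pairSum-mono [] v≤w = z≤n
  pairSum-mono (x ∷ xs) v≤w = +-mono-≤ (∑-mono xs (v≤w x)) (pairSum-mono xs v≤w)

  pairSum-zero : (w : A → A → ℕ) → (∀ a b → w a b ≡ 0) → (xs : List A) → pairSum w xs ≡ 0
  pairSum-zero w w≡0 [] = refl
  pairSum-zero w w≡0 (x ∷ xs) =
    cong₂ _+_ (trans (∑-cong-∈ xs (λ {y} _ → w≡0 x y)) (∑-zero xs)) (pairSum-zero w w≡0 xs)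

  pairSum-⊆ : (w : A → A → ℕ) {xs ys : List A} → xs ⊆ ys → pairSum w xs ≤ pairSum w ys
  pairSum-⊆ w [] = z≤n
  pairSum-⊆ w (y ∷ʳ p) = ≤-trans (pairSum-⊆ w p) (m≤n+m _ _)
  pairSum-⊆ w (refl ∷ p) = +-mono-≤ (∑-⊆ (w _) p) (pairSum-⊆ w p)

  pairSum-concat : (w : A → A → ℕ) (xss : List (List A)) → ∑ (pairSum w) xss ≤ pairSum w (concat xss)
  pairSum-concat w [] = z≤n
  pairSum-concat w (xs ∷ xss) rewrite pairSum-++ w xs (concat xss) =
    ≤-trans (+-monoʳ-≤ (pairSum w xs) (pairSum-concat w xss)) (m≤m+n _ _)

  crossSum-⊆ : (w : A → A → ℕ) {xs xs' ys ys' : List A} → xs ⊆ xs' → ys ⊆ ys' →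
               crossSum w xs ys ≤ crossSum w xs' ys'
  crossSum-⊆ w {xs' = xs'} {ys} p q =
    ≤-trans (∑-⊆ (λ x → ∑ (w x) ys) p) (∑-mono xs' (λ x → ∑-⊆ (w x) q))

pairSum-map : {A B : Set} (w : B → B → ℕ) (f : A → B) (xs : List A) →
              pairSum w (map f xs) ≡ pairSum (λ a b → w (f a) (f b)) xs
pairSum-map w f [] = refl
pairSum-map w f (x ∷ xs) = cong₂ _+_ (∑-map (w (f x)) f xs) (pairSum-map w f xs)

crossSum-concatMap : {A B : Set} (v : A → A → ℕ) (w : B → B → ℕ) (h : A → List B) →
                     (∀ a b → v a b ≤ crossSum w (h a) (h b)) → (xs ys : List A) →
                     crossSum v xs ys ≤ crossSum w (concatMap h xs) (concatMap h ys)
crossSum-concatMap v w h v≤w xs ys = begin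
    crossSum v xs ys
  ≤⟨ ∑-mono xs (λ x → ∑-mono ys (v≤w x)) ⟩
    ∑ (λ x → ∑ (λ y → crossSum w (h x) (h y)) ys) xs
  ≡⟨ ∑-cong-∈ xs (λ {x} _ → sym (crossSum-concatMapʳ (h x))) ⟩
    ∑ (λ x → crossSum w (h x) (concatMap h ys)) xs
  ≡⟨ sym (trans (∑-concat _ (map h xs)) (∑-map _ h xs)) ⟩
    crossSum w (concatMap h xs) (concatMap h ys) ∎
  where
    open ≤-Reasoning
    crossSum-concatMapʳ : ∀ zs → crossSum w zs (concatMap h ys) ≡ ∑ (λ y → crossSum w zs (h y)) ys
    crossSum-concatMapʳ zs =
      trans (∑-cong-∈ zs (λ {z} _ → trans (∑-concat (w z) (map h ys)) (∑-map (∑ (w z)) h ys)))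
            (∑-swap (λ z y → ∑ (w z) (h y)) zs ys)
segment : ℕ → ℕ → List ℕ
segment a zero = []
segment a (suc m) = a ∷ segment (suc a) m

segmentOf : ℕ × ℕ → List ℕ
segmentOf (a , m) = segment a m

segment-++ : ∀ a l m → segment a (l + m) ≡ segment a l ++ segment (a + l) m
segment-++ a zero m = cong (λ b → segment b m) (sym (+-identityʳ a))
segment-++ a (suc l) m =
  cong (a ∷_) (trans (segment-++ (suc a) l m) (cong (λ b → segment (suc a) l ++ segment b m) (sym (+-suc a l))))

∈-segment⁻ : ∀ {x a m} → x ∈ segment a m → a ≤ x × x < a + m
∈-segment⁻ {x} {m = suc m} (here refl) = ≤-refl , subst (x <_) (sym (+-suc x m)) (s≤s (m≤m+n x m))
∈-segment⁻ {x} {a} {suc m} (there x∈) with ∈-segment⁻ x∈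
... | a<x , x<a+m = <⇒≤ a<x , subst (x <_) (sym (+-suc a m)) x<a+m

∈-segment⁺ : ∀ {x a m} → a ≤ x → x < a + m → x ∈ segment a m
∈-segment⁺ {x} {a} {zero} a≤x x<a+0 = ⊥-elim (<⇒≱ x<a+0 (subst (_≤ x) (sym (+-identityʳ a)) a≤x))
∈-segment⁺ {x} {a} {suc m} a≤x x<a+m with m≤n⇒m<n∨m≡n a≤x
... | inj₂ refl = here refl
... | inj₁ a<x = there (∈-segment⁺ a<x (subst (x <_) (+-suc a m) x<a+m))

map-applyUpTo≡segment : ∀ (g h : ℕ → ℕ) a m → (∀ i → g (h i) ≡ a + i) → map g (applyUpTo h m) ≡ segment a m
map-applyUpTo≡segment g h a zero gh≡ = refl
map-applyUpTo≡segment g h a (suc m) gh≡ =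
  cong₂ _∷_ (trans (gh≡ 0) (+-identityʳ a))
            (map-applyUpTo≡segment g (h ∘ suc) (suc a) m (λ i → trans (gh≡ (suc i)) (+-suc a i)))

range≡segment : ∀ a m → range a m ≡ segment a m
range≡segment a m = map-applyUpTo≡segment (a +_) (λ i → i) a m (λ _ → refl)

upTo≡segment : ∀ m → upTo m ≡ segment 0 m
upTo≡segment m = trans (sym (map-id (upTo m))) (map-applyUpTo≡segment (λ i → i) (λ i → i) 0 m (λ _ → refl))

map-segment-suc : {A : Set} (f : ℕ → A) (a m : ℕ) → map f (segment (suc a) m) ≡ map (f ∘ suc) (segment a m)
map-segment-suc f a zero = refl
map-segment-suc f a (suc m) = cong (f (suc a) ∷_) (map-segment-suc f (suc a) m)

map-at-segment : {A : Set} (d : A) (xs : List A) → map (at d xs) (segment 0 (length xs)) ≡ xs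
map-at-segment d [] = refl
map-at-segment d (x ∷ xs) =
  cong (x ∷_) (trans (map-segment-suc (at d (x ∷ xs)) 0 (length xs)) (map-at-segment d xs))

<ᵇ-true : ∀ {m n} → m < n → (m <ᵇ n) ≡ true
<ᵇ-true {m} {n} m<n = Equivalence.to T-≡ (<⇒<ᵇ m<n)

<ᵇ-false : ∀ {m n} → n ≤ m → (m <ᵇ n) ≡ false
<ᵇ-false {m} {n} n≤m with m <ᵇ n in m<ᵇn
... | false = refl
... | true = ⊥-elim (≤⇒≯ n≤m (<ᵇ⇒< m n (Equivalence.from T-≡ m<ᵇn)))

≤ᵇ-true : ∀ {m n} → m ≤ n → (m ≤ᵇ n) ≡ true
≤ᵇ-true m≤n = Equivalence.to T-≡ (≤⇒≤ᵇ m≤n)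

≡ᵇ-refl : ∀ n → (n ≡ᵇ n) ≡ true
≡ᵇ-refl n = Equivalence.to T-≡ (≡⇒≡ᵇ n n refl)

∧-true⁻ˡ : ∀ a {b} → (a ∧ b) ≡ true → a ≡ true
∧-true⁻ˡ true _ = refl

not-∨-false⁻ : ∀ {a b} → (not a ∨ b) ≡ false → a ≡ true × b ≡ false
not-∨-false⁻ {true} {false} _ = refl , refl

module _ {A : Set} where

  all-false⁻ : (p : A → Bool) (xs : List A) → all p xs ≡ false → ∃[ x ] (x ∈ xs × p x ≡ false)
  all-false⁻ p (x ∷ xs) eq with p x in px
  ... | false = x , here refl , px
  ... | true with all-false⁻ p xs eq
  ... | y , y∈xs , py = y , there y∈xs , py

  any-false⁻ : (p : A → Bool) (xs : List A) → any p xs ≡ false → ∀ {x} → x ∈ xs → p x ≡ false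
  any-false⁻ p (x ∷ xs) eq x∈ with p x in px
  any-false⁻ p (x ∷ xs) () x∈ | true
  any-false⁻ p (x ∷ xs) eq (here refl) | false = px
  any-false⁻ p (x ∷ xs) eq (there x∈) | false = any-false⁻ p xs eq x∈

  all-true⁺ : (p : A → Bool) (xs : List A) → (∀ {x} → x ∈ xs → p x ≡ true) → all p xs ≡ true
  all-true⁺ p [] h = refl
  all-true⁺ p (x ∷ xs) h rewrite h (here refl) = all-true⁺ p xs (h ∘ there)

  all-true⁻ : (p : A → Bool) (xs : List A) → all p xs ≡ true → ∀ {x} → x ∈ xs → p x ≡ true
  all-true⁻ p (x ∷ xs) eq x∈ with p x in px
  all-true⁻ p (x ∷ xs) eq (here refl) | true = px
  all-true⁻ p (x ∷ xs) eq (there x∈) | true = all-true⁻ p xs eq x∈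

  ⟦any⟧≤∑ : (p : A → Bool) (xs : List A) → ⟦ any p xs ⟧ ≤ ∑ (λ x → ⟦ p x ⟧) xs
  ⟦any⟧≤∑ p [] = z≤n
  ⟦any⟧≤∑ p (x ∷ xs) with p x
  ... | true = s≤s z≤n
  ... | false = ⟦any⟧≤∑ p xs

  filterB-⊆ : (p : A → Bool) (xs : List A) → filterB p xs ⊆ xs
  filterB-⊆ p [] = []
  filterB-⊆ p (x ∷ xs) with p x
  ... | true = refl ∷ filterB-⊆ p xs
  ... | false = x ∷ʳ filterB-⊆ p xs

  length-filterB : (p : A → Bool) (xs : List A) → length (filterB p xs) ≡ ∑ (λ x → ⟦ p x ⟧) xs
  length-filterB p [] = refl
  length-filterB p (x ∷ xs) with p x
  ... | true = cong suc (length-filterB p xs)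
  ... | false = length-filterB p xs

  filterB≡[]⁻ : (p : A → Bool) (xs : List A) → filterB p xs ≡ [] → ∀ {x} → x ∈ xs → p x ≡ false
  filterB≡[]⁻ p (x ∷ xs) eq x∈ with p x in px
  filterB≡[]⁻ p (x ∷ xs) () x∈ | true
  filterB≡[]⁻ p (x ∷ xs) eq (here refl) | false = px
  filterB≡[]⁻ p (x ∷ xs) eq (there x∈) | false = filterB≡[]⁻ p xs eq x∈

  dropWhileB-⊆ : (p : A → Bool) (xs : List A) → dropWhileB p xs ⊆ xs
  dropWhileB-⊆ p [] = []
  dropWhileB-⊆ p (x ∷ xs) with p x
  ... | true = x ∷ʳ dropWhileB-⊆ p xs
  ... | false = ⊆-refl

  length-concat : (xss : List (List A)) → length (concat xss) ≡ ∑ length xss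
  length-concat [] = refl
  length-concat (xs ∷ xss) = trans (length-++ xs) (cong (length xs +_) (length-concat xss))

trim-⊆ : (p : QV → Bool) (vs : List QV) → trim p vs ⊆ vs
trim-⊆ p vs = ⊆-trans (reverse⁺ (dropWhileB-⊆ p' (reverse front)))
                      (subst (_⊆ vs) (sym (reverse-involutive front)) (dropWhileB-⊆ p' vs))
  where
    p' = λ v → not (p v)
    front = dropWhileB p' vs

edges≡∑∑ : (H : OGraph) →
           edges H ≡ ∑ (λ i → ∑ (λ j → ⟦ (i <ᵇ j) ∧ E H i j ⟧) (upTo (size H))) (upTo (size H))
edges≡∑∑ H = trans (length-concat (map row (upTo n)))
                   (trans (∑-map length row (upTo n)) (∑-cong-∈ (upTo n) (λ _ → length-filterB _ (upTo n))))
  where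
    n = size H
    row = λ i → filterB (λ j → (i <ᵇ j) ∧ E H i j) (upTo n)

∑∑≡pairSum : (E : ℕ → ℕ → Bool) (a m : ℕ) →
             ∑ (λ i → ∑ (λ j → ⟦ (i <ᵇ j) ∧ E i j ⟧) (segment a m)) (segment a m) ≡ pairSum ⟪ E ⟫ (segment a m)
∑∑≡pairSum E a zero = refl
∑∑≡pairSum E a (suc m) =
  trans (cong₂ _+_ row-a other-rows) (cong (∑ (⟪ E ⟫ a) later +_) (∑∑≡pairSum E (suc a) m))
  where
    later = segment (suc a) m
    row-a : ∑ (λ j → ⟦ (a <ᵇ j) ∧ E a j ⟧) (a ∷ later) ≡ ∑ (⟪ E ⟫ a) later
    row-a rewrite <ᵇ-false {a} {a} ≤-refl =
      ∑-cong-∈ later (λ {j} j∈ → cong (λ b → ⟦ b ∧ E a j ⟧) (<ᵇ-true (proj₁ (∈-segment⁻ j∈))))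
    other-rows : ∑ (λ i → ∑ (λ j → ⟦ (i <ᵇ j) ∧ E i j ⟧) (a ∷ later)) later
               ≡ ∑ (λ i → ∑ (λ j → ⟦ (i <ᵇ j) ∧ E i j ⟧) later) later
    other-rows = ∑-cong-∈ later (λ {i} i∈ →
      cong (λ b → ⟦ b ∧ E i a ⟧ + ∑ (λ j → ⟦ (i <ᵇ j) ∧ E i j ⟧) later)
           (<ᵇ-false (<⇒≤ (proj₁ (∈-segment⁻ i∈)))))

edges≡pairSum : (H : OGraph) → edges H ≡ pairSum ⟪ E H ⟫ (segment 0 (size H))
edges≡pairSum H =
  trans (edges≡∑∑ H)
        (trans (cong (λ is → ∑ (λ i → ∑ (λ j → ⟦ (i <ᵇ j) ∧ E H i j ⟧) is) is) (upTo≡segment (size H)))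
               (∑∑≡pairSum (E H) 0 (size H)))

edges-mkGraph : {A : Set} (d : A) (vs : List A) (P : A → A → Bool) → edges (mkGraph d vs P) ≡ pairSum ⟪ P ⟫ vs
edges-mkGraph d vs P =
  trans (edges≡pairSum (mkGraph d vs P))
        (trans (sym (pairSum-map ⟪ P ⟫ (at d vs) (segment 0 (length vs)))) (cong (pairSum ⟪ P ⟫) (map-at-segment d vs)))

pairSum-adj : (G : OGraph) (a m : ℕ) → pairSum ⟪ adj G ⟫ (segment a m) ≡ pairSum ⟪ E G ⟫ (segment a m)
pairSum-adj G a zero = refl
pairSum-adj G a (suc m) = cong₂ _+_ (∑-cong-∈ (segment (suc a) m) adj≡E) (pairSum-adj G (suc a) m)
  where
    adj≡E : ∀ {j} → j ∈ segment (suc a) m → ⟦ adj G a j ⟧ ≡ ⟦ E G a j ⟧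
    adj≡E {j} j∈ rewrite <ᵇ-true (proj₁ (∈-segment⁻ j∈)) | <ᵇ-false {j} {a} (<⇒≤ (proj₁ (∈-segment⁻ j∈))) =
      cong ⟦_⟧ (∨-identityʳ (E G a j))

module _ (H : OGraph) where

  private
    n = size H

    isEdge : ℕ → ℕ → Bool
    isEdge i j = (i <ᵇ j) ∧ E H i j

    rowCount : ℕ → ℕ
    rowCount i = ∑ (λ j → ⟦ isEdge i j ⟧) (upTo n)

  two-edges⇒2≤edges : ∀ {i j i' j'} → i ∈ upTo n → j ∈ upTo n → i' ∈ upTo n → j' ∈ upTo n →
                      isEdge i j ≡ true → isEdge i' j' ≡ true → (i ≡ i' → j ≢ j') → 2 ≤ edges H
  two-edges⇒2≤edges {i} {j} {i'} {j'} i∈ j∈ i'∈ j'∈ ij ij' distinct =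
    subst (2 ≤_) (sym (edges≡∑∑ H)) (by-rows (i ≟ i'))
    where
      by-rows : Dec (i ≡ i') → 2 ≤ ∑ rowCount (upTo n)
      by-rows (no i≢i') =
        ≤-trans (+-mono-≤ (≤-trans (⟦⟧-true ij) (∑-∈ _ j∈)) (≤-trans (⟦⟧-true ij') (∑-∈ _ j'∈)))
                (∑-∈₂ rowCount i∈ i'∈ i≢i')
      by-rows (yes refl) =
        ≤-trans (+-mono-≤ (⟦⟧-true ij) (⟦⟧-true ij'))
                (≤-trans (∑-∈₂ (λ j → ⟦ isEdge i j ⟧) j∈ j'∈ (distinct refl)) (∑-∈ rowCount i∈))

  private
    crosses : ℕ → ℕ → ℕ → Bool
    crosses s i j = (i <ᵇ s) ∧ (s ≤ᵇ j)

    violatedCut : isMB H ≡ false → ∀ s → s ≤ n →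
                  ∃[ i ] ∃[ j ] (i ∈ upTo n × j ∈ upTo n × isEdge i j ≡ true × crosses s i j ≡ false)
    violatedCut notMB s s≤n
      with all-false⁻ _ (upTo n) (any-false⁻ _ (upTo (suc n)) notMB (∈-upTo⁺ (s≤s s≤n)))
    ... | i , i∈ , row-i with all-false⁻ _ (upTo n) row-i
    ... | j , j∈ , ij = i , j , i∈ , j∈ , not-∨-false⁻ ij

  -- Cut 0 is crossed by no edge, so some edge ij exists; cut j is then violated by an edge,
  -- which differs from ij because ij crosses cut j.
  nonMB⇒2≤edges : isMB H ≡ false → 2 ≤ edges H
  nonMB⇒2≤edges notMB with violatedCut notMB 0 z≤n
  ... | i , j , i∈ , j∈ , ij , _ with violatedCut notMB j (<⇒≤ (∈-upTo⁻ j∈))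
  ... | i' , j' , i'∈ , j'∈ , i'j' , i'j'∤j =
    two-edges⇒2≤edges i∈ j∈ i'∈ j'∈ ij i'j' λ { refl refl → ij-crosses-j i'j'∤j }
    where
      ij-crosses-j : crosses j i j ≡ false → ⊥
      ij-crosses-j rewrite ∧-true⁻ˡ (i <ᵇ j) ij | ≤ᵇ-true (≤-refl {j}) = λ ()

four-classes : ∀ r₁ l₁ r₂ l₂ q → (r₁ ∧ l₁) ≡ false → (r₂ ∧ l₂) ≡ false →
  ⟦ r₁ ∧ r₂ ∧ q ⟧ + (⟦ r₁ ∧ l₂ ∧ q ⟧ + (⟦ l₁ ∧ r₂ ∧ q ⟧ + ⟦ l₁ ∧ l₂ ∧ q ⟧)) ≤ ⟦ q ⟧
four-classes true true _ _ _ () _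
four-classes _ _ true true _ _ ()
four-classes false false _ _ _ _ _ = z≤n
four-classes true false false false _ _ _ = z≤n
four-classes false true false false _ _ _ = z≤n
four-classes true false true false true _ _ = ≤-refl
four-classes true false false true true _ _ = ≤-refl
four-classes false true true false true _ _ = ≤-refl
four-classes false true false true true _ _ = ≤-refl
four-classes true false true false false _ _ = z≤n
four-classes true false false true false _ _ = z≤n
four-classes false true true false false _ _ = z≤n
four-classes false true false true false _ _ = z≤n

R'∩L'≡∅ : ∀ l → (inR' l ∧ inL' l) ≡ false
R'∩L'≡∅ ∅ = refl
R'∩L'≡∅ Lr = refl
R'∩L'≡∅ Ll = refl
R'∩L'≡∅ O = refl
R'∩L'≡∅ Or = refl
R'∩L'≡∅ Ol = refl

module NodeQuotient (G : OGraph) where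
  open Decomp G

  quotientAdj : QV → QV → Bool
  quotientAdj a b = not (pidx a ≡ᵇ pidx b) ∧ edgeBetween (qiv a) (qiv b)

  quotientGraph : List QV → OGraph
  quotientGraph vs = mkGraph dQV vs quotientAdj

  edgeClass : (Label → Bool) → (Label → Bool) → QV → QV → Bool
  edgeClass left right a b = left (typ a) ∧ right (typ b) ∧ quotientAdj a b

  -- pidx 0 marks the children of the first child of x.
  survivors : List QV → Label → List QV
  survivors vs l₀ = if isO l₀ then filterB (λ v → not (pidx v ≡ᵇ 0)) vs else vs

  trimR trimL : List QV → Label → List QV
  trimR vs l₀ = trim (λ v → isR (typ v)) (survivors vs l₀)
  trimL vs l₀ = trim (λ v → isL (typ v)) (survivors vs l₀)

  refinedOf : Bool → List QV → Label → List OGraph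
  refinedOf isMonotone vs l₀ = if isMonotone then quotientGraph vs ∷ [] else
      ( mkGraph dQV (trimR vs l₀) (edgeClass inR' inR')
    ∷ mkGraph dQV (trimL vs l₀) (edgeClass inR' inL')
    ∷ mkGraph dQV (trimR vs l₀) (edgeClass inL' inR')
    ∷ mkGraph dQV (trimL vs l₀) (edgeClass inL' inL')
    ∷ [])

  survivors-⊆ : ∀ vs l₀ → survivors vs l₀ ⊆ vs
  survivors-⊆ vs l₀ with isO l₀
  ... | true = filterB-⊆ _ vs
  ... | false = ⊆-refl

  trimR-⊆ : ∀ vs l₀ → trimR vs l₀ ⊆ vs
  trimR-⊆ vs l₀ = ⊆-trans (trim-⊆ _ (survivors vs l₀)) (survivors-⊆ vs l₀)

  trimL-⊆ : ∀ vs l₀ → trimL vs l₀ ⊆ vs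
  trimL-⊆ vs l₀ = ⊆-trans (trim-⊆ _ (survivors vs l₀)) (survivors-⊆ vs l₀)

  edgeClasses-≤ : ∀ a b → ⟪ edgeClass inR' inR' ⟫ a b + (⟪ edgeClass inR' inL' ⟫ a b
                    + (⟪ edgeClass inL' inR' ⟫ a b + ⟪ edgeClass inL' inL' ⟫ a b)) ≤ ⟪ quotientAdj ⟫ a b
  edgeClasses-≤ a b = four-classes (inR' (typ a)) (inL' (typ a)) (inR' (typ b)) (inL' (typ b)) (quotientAdj a b)
                                   (R'∩L'≡∅ (typ a)) (R'∩L'≡∅ (typ b))

  refined-length : ∀ vs l₀ → length (refinedOf (isMB (quotientGraph vs)) vs l₀) ≤ 1 + 2 * edges (quotientGraph vs)
  refined-length vs l₀ with isMB (quotientGraph vs) in mb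
  ... | true = s≤s z≤n
  ... | false = s≤s (≤-trans (n≤1+n 3) (*-monoʳ-≤ 2 (nonMB⇒2≤edges (quotientGraph vs) mb)))

  refined-sizes : ∀ b vs l₀ → All (λ H → size H ≤ length vs) (refinedOf b vs l₀)
  refined-sizes true vs l₀ = ≤-refl ∷ []
  refined-sizes false vs l₀ = R ∷ L ∷ R ∷ L ∷ []
    where
      R = length-mono-≤ (trimR-⊆ vs l₀)
      L = length-mono-≤ (trimL-⊆ vs l₀)

  refined-edges : ∀ b vs l₀ → ∑ edges (refinedOf b vs l₀) ≤ edges (quotientGraph vs)
  refined-edges true vs l₀ = ≤-reflexive (+-identityʳ _)
  refined-edges false vs l₀ = begin
      edges (mkGraph dQV R RR) + (edges (mkGraph dQV L RL) + (edges (mkGraph dQV R LR) + (edges (mkGraph dQV L LL) + 0)))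
    ≡⟨ cong₂ _+_ (edges-mkGraph dQV R RR) (cong₂ _+_ (edges-mkGraph dQV L RL)
         (cong₂ _+_ (edges-mkGraph dQV R LR) (trans (+-identityʳ _) (edges-mkGraph dQV L LL)))) ⟩
      pairSum ⟪ RR ⟫ R + (pairSum ⟪ RL ⟫ L + (pairSum ⟪ LR ⟫ R + pairSum ⟪ LL ⟫ L))
    ≤⟨ +-mono-≤ (pairSum-⊆ ⟪ RR ⟫ R⊆) (+-mono-≤ (pairSum-⊆ ⟪ RL ⟫ L⊆)
         (+-mono-≤ (pairSum-⊆ ⟪ LR ⟫ R⊆) (pairSum-⊆ ⟪ LL ⟫ L⊆))) ⟩
      pairSum ⟪ RR ⟫ vs + (pairSum ⟪ RL ⟫ vs + (pairSum ⟪ LR ⟫ vs + pairSum ⟪ LL ⟫ vs))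
    ≡⟨ sym (trans (pairSum-+ _ _ vs) (cong (pairSum ⟪ RR ⟫ vs +_) (trans (pairSum-+ _ _ vs)
         (cong (pairSum ⟪ RL ⟫ vs +_) (pairSum-+ _ _ vs))))) ⟩
      pairSum (λ a b → ⟪ RR ⟫ a b + (⟪ RL ⟫ a b + (⟪ LR ⟫ a b + ⟪ LL ⟫ a b))) vs
    ≤⟨ pairSum-mono vs edgeClasses-≤ ⟩
      pairSum ⟪ quotientAdj ⟫ vs
    ≡⟨ sym (edges-mkGraph dQV vs quotientAdj) ⟩
      edges (quotientGraph vs) ∎
    where
      open ≤-Reasoning
      R = trimR vs l₀
      L = trimL vs l₀
      R⊆ = trimR-⊆ vs l₀
      L⊆ = trimL-⊆ vs l₀
      RR = edgeClass inR' inR'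
      RL = edgeClass inR' inL'
      LR = edgeClass inL' inR'
      LL = edgeClass inL' inL' 
data Tiling : ℕ → ℕ → List (ℕ × ℕ) → Set where
  [] : ∀ {a} → Tiling a 0 []
  tile : ∀ {a c n l m is} → 1 ≤ l → a + l ≡ c → n ≡ l + m → Tiling c m is → Tiling a n ((a , l) ∷ is)

data Decomposes : ℕ → ℕ → Tree → Set where
  singleton : ∀ lo → Decomposes lo 1 (node lo 1 (leaf lo ∷ []))
  split : ∀ {lo len cs} → Tiling lo len (map ival cs) → 2 ≤ length cs →
          All (λ c → Decomposes (proj₁ (ival c)) (proj₂ (ival c)) c) cs → Decomposes lo len (node lo len cs)

data Ascending : ℕ → List ℕ → ℕ → Set where
  [] : ∀ {a e} → a < e → Ascending a [] e
  _∷_ : ∀ {a b bs e} → a < b → Ascending b bs e → Ascending a (b ∷ bs) e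

ascending-< : ∀ {a bs e} → Ascending a bs e → a < e
ascending-< ([] a<e) = a<e
ascending-< (a<b ∷ asc) = <-trans a<b (ascending-< asc)

ascending-weaken : ∀ {a b bs e} → a < b → Ascending b bs e → Ascending a bs e
ascending-weaken a<b ([] b<e) = [] (<-trans a<b b<e)
ascending-weaken a<b (b<c ∷ asc) = <-trans a<b b<c ∷ asc

ascending-filterB : ∀ {a bs e} (p : ℕ → Bool) → Ascending a bs e → Ascending a (filterB p bs) e
ascending-filterB p ([] a<e) = [] a<e
ascending-filterB p (_∷_ {b = b} a<b asc) with p b
... | true = a<b ∷ ascending-filterB p asc
... | false = ascending-weaken a<b (ascending-filterB p asc)

ascending-segment : ∀ a m e → a + m < e → Ascending a (segment (suc a) m) e
ascending-segment a zero e a+0<e = [] (subst (_< e) (+-identityʳ a) a+0<e)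
ascending-segment a (suc m) e a+m<e =
  n<1+n a ∷ ascending-segment (suc a) m e (subst (_< e) (+-suc a m) a+m<e)

tiling-segments : ∀ {a n is} → Tiling a n is → concatMap segmentOf is ≡ segment a n
tiling-segments [] = refl
tiling-segments {a} (tile {l = l} {m} _ refl refl T) = trans (cong (segment a l ++_) (tiling-segments T)) (sym (segment-++ a l m))

tiling-lengths : ∀ {a n is} → Tiling a n is → ∑ proj₂ is ≡ n
tiling-lengths [] = refl
tiling-lengths (tile _ _ refl T) = cong (_ +_) (tiling-lengths T)

tiling-count : ∀ {a n is} → Tiling a n is → length is ≤ n
tiling-count [] = z≤n
tiling-count (tile 1≤l _ refl T) = +-mono-≤ 1≤l (tiling-count T)

tiling-pieces : ∀ {a n is} → Tiling a n is → All (λ p → 1 ≤ proj₂ p × proj₂ p ≤ n) is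
tiling-pieces [] = []
tiling-pieces (tile {l = l} {m} 1≤l _ refl T) =
  (1≤l , m≤m+n l m) ∷ All.map (λ (1≤l' , l'≤m) → 1≤l' , ≤-trans l'≤m (m≤n+m m l)) (tiling-pieces T)

tiling-proper-pieces : ∀ {a n is} → Tiling a n is → 2 ≤ length is → All (λ p → 1 ≤ proj₂ p × proj₂ p < n) is
tiling-proper-pieces (tile _ _ refl []) (s≤s ())
tiling-proper-pieces (tile {l = l} {m} 1≤l _ refl T@(tile 1≤l' _ refl _)) _ =
  (1≤l , subst (_≤ l + m) (+-comm l 1) (+-monoʳ-≤ l (≤-trans 1≤l' (m≤m+n _ _))))
  ∷ All.map (λ (1≤l'' , l''≤m) → 1≤l'' , ≤-trans (s≤s l''≤m) (+-monoˡ-≤ m 1≤l)) (tiling-pieces T)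

grandchildVertices : Tree → List ℕ
grandchildVertices c = concatMap (segmentOf ∘ ival) (children c)

decomposes-grandchildVertices : ∀ {lo len x} → Decomposes lo len x → grandchildVertices x ≡ segment lo len
decomposes-grandchildVertices (singleton lo) = refl
decomposes-grandchildVertices (split {cs = cs} T _ _) = trans (cong concat (map-∘ cs)) (tiling-segments T)

decomposes-children : ∀ {lo len x} → Decomposes lo len x → length (children x) ≤ len
decomposes-children (singleton lo) = ≤-refl
decomposes-children (split {cs = cs} T _ _) = subst (_≤ _) (length-map ival cs) (tiling-count T)

module DecompositionShape (G : OGraph) where
  open Decomp G

  ascending-tiling : ∀ {s ts e} → Ascending s ts e → Tiling s (e ∸ s) (intervalsFrom (s ∷ ts) e)
  ascending-tiling {s} {[]} {e} ([] s<e) = tile (m<n⇒0<n∸m s<e) (m+[n∸m]≡n (<⇒≤ s<e)) (sym (+-identityʳ _)) []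
  ascending-tiling {s} {t ∷ ts} {e} (s<t ∷ asc) =
    tile (m<n⇒0<n∸m s<t) (m+[n∸m]≡n (<⇒≤ s<t)) e∸s≡ (ascending-tiling asc)
    where
      e∸s≡ : e ∸ s ≡ (t ∸ s) + (e ∸ t)
      e∸s≡ = begin
        e ∸ s                 ≡⟨ cong (_∸ s) (sym (m+[n∸m]≡n (<⇒≤ (ascending-< asc)))) ⟩
        t + (e ∸ t) ∸ s       ≡⟨ +-∸-comm (e ∸ t) (<⇒≤ s<t) ⟩
        (t ∸ s) + (e ∸ t)     ∎
        where open ≡-Reasoning

  length-intervalsFrom : ∀ s ts e → length (intervalsFrom (s ∷ ts) e) ≡ suc (length ts)
  length-intervalsFrom s [] e = refl
  length-intervalsFrom s (t ∷ ts) e = cong suc (length-intervalsFrom t ts e)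

  ival-build : ∀ f lo len → ival (build f lo len) ≡ (lo , len)
  ival-build zero lo len = refl
  ival-build (suc f) lo zero = refl
  ival-build (suc f) lo (suc zero) = refl
  ival-build (suc f) lo (suc (suc k)) with isModule lo (suc (suc k))
  ... | true = refl
  ... | false = refl

  -- the left ends of the classes of ∼, other than lo itself
  boundaries : ℕ → ℕ → List ℕ
  boundaries lo len = filterB (λ u → not (sameOut lo len (u ∸ 1) u)) (range (suc lo) (len ∸ 1))

  classes-tiling : ∀ lo k → Tiling lo (suc (suc k)) (classes lo (suc (suc k)))
  classes-tiling lo k =
    subst (λ n → Tiling lo n (classes lo (suc (suc k)))) (m+n∸m≡n lo (suc (suc k)))
      (ascending-tiling (ascending-filterB _
        (subst (λ us → Ascending lo us (lo + suc (suc k))) (sym (range≡segment (suc lo) (suc k)))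
          (ascending-segment lo (suc k) (lo + suc (suc k)) (+-monoʳ-< lo (n<1+n (suc k)))))))

  private
    agree : ∀ a b → ((a ∧ b) ∨ (not a ∧ not b)) ≡ true → a ≡ b
    agree true true _ = refl
    agree false false _ = refl

    module NoBoundary (lo L : ℕ) (2≤L : 2 ≤ L) (none : boundaries lo L ≡ []) where

      sameAsPredecessor : ∀ {u} → suc lo ≤ u → u < lo + L → ∀ {w} → w ∈ outside lo L → adj G (u ∸ 1) w ≡ adj G u w
      sameAsPredecessor {u} lo<u u<lo+L w∈ = agree _ _ (all-true⁻ _ (outside lo L) same w∈)
        where
          u∈ : u ∈ range (suc lo) (L ∸ 1)
          end≡ : suc lo + (L ∸ 1) ≡ lo + L
          end≡ = trans (sym (+-suc lo (L ∸ 1))) (cong (lo +_) (m+[n∸m]≡n (≤-trans (s≤s z≤n) 2≤L)))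
          u∈ = subst (u ∈_) (sym (range≡segment (suc lo) (L ∸ 1)))
                 (∈-segment⁺ lo<u (subst (u <_) (sym end≡) u<lo+L))
          same : sameOut lo L (u ∸ 1) u ≡ true
          same with sameOut lo L (u ∸ 1) u | filterB≡[]⁻ _ _ none u∈
          ... | true | _ = refl

      sameAsFirst : ∀ t → t < L → ∀ {w} → w ∈ outside lo L → adj G (lo + t) w ≡ adj G lo w
      sameAsFirst zero _ _ = cong (λ u → adj G u _) (+-identityʳ lo)
      sameAsFirst (suc t) t<L {w} w∈ =
        trans (trans (sym (sameAsPredecessor (subst (suc lo ≤_) (sym (+-suc lo t)) (s≤s (m≤m+n lo t))) (+-monoʳ-< lo t<L) w∈))
                     (cong (λ u → adj G (u ∸ 1) w) (+-suc lo t)))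
              (sameAsFirst t (<-trans (n<1+n t) t<L) w∈)

      sameAsFirst-∈ : ∀ {u} → u ∈ range lo L → ∀ {w} → w ∈ outside lo L → adj G u w ≡ adj G lo w
      sameAsFirst-∈ {u} u∈ w∈ with ∈-segment⁻ (subst (u ∈_) (range≡segment lo L) u∈)
      ... | lo≤u , u<lo+L =
        trans (cong (λ v → adj G v _) (sym (m+[n∸m]≡n lo≤u)))
              (sameAsFirst (u ∸ lo) (subst (u ∸ lo <_) (m+n∸m≡n lo L) (∸-monoˡ-< u<lo+L lo≤u)) w∈)

      isModule-true : isModule lo L ≡ true
      isModule-true = all-true⁺ _ (outside lo L) uniform
        where
          uniform : ∀ {w} → w ∈ outside lo L →
                    (all (λ u → adj G u w) (range lo L) ∨ all (λ u → not (adj G u w)) (range lo L)) ≡ true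
          uniform {w} w∈ with adj G lo w in lo~w
          ... | true rewrite all-true⁺ (λ u → adj G u w) (range lo L) (λ u∈ → trans (sameAsFirst-∈ u∈ w∈) lo~w) = refl
          ... | false
            rewrite all-true⁺ (λ u → not (adj G u w)) (range lo L) (λ u∈ → cong not (trans (sameAsFirst-∈ u∈ w∈) lo~w)) =
            ∨-zeroʳ _

  nonModule⇒2≤classes : ∀ lo k → isModule lo (suc (suc k)) ≡ false → 2 ≤ length (classes lo (suc (suc k)))
  nonModule⇒2≤classes lo k notModule =
    subst (2 ≤_) (sym (length-intervalsFrom lo (boundaries lo L) (lo + L))) (s≤s (some-boundary (boundaries lo L) refl))
    where
      L = suc (suc k)
      some-boundary : (bs : List ℕ) → boundaries lo L ≡ bs → 1 ≤ length bs
      some-boundary [] none with trans (sym notModule) (NoBoundary.isModule-true lo L (s≤s (s≤s z≤n)) none)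
      ... | ()
      some-boundary (_ ∷ _) _ = s≤s z≤n

  map-ival-build : ∀ f (ps : List (ℕ × ℕ)) → map ival (map (λ p → build f (proj₁ p) (proj₂ p)) ps) ≡ ps
  map-ival-build f [] = refl
  map-ival-build f ((a , b) ∷ ps) = cong₂ _∷_ (ival-build f a b) (map-ival-build f ps)

  mutual
    build-decomposes : ∀ f lo len → 1 ≤ len → len ≤ f → Decomposes lo len (build f lo len)
    build-decomposes zero lo len 1≤len len≤0 = ⊥-elim (<⇒≱ 1≤len len≤0)
    build-decomposes (suc f) lo (suc zero) _ _ = singleton lo
    build-decomposes (suc f) lo (suc (suc k)) _ (s≤s len≤f) with isModule lo (suc (suc k)) in isMod
    ... | true =
      split (subst (Tiling lo L) (sym (cong₂ (λ x y → x ∷ y ∷ []) (ival-build f lo 1) (ival-build f (suc lo) (suc k))))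
                   (tile (s≤s z≤n) (+-comm lo 1) refl (tile (s≤s z≤n) refl (sym (+-identityʳ _)) [])))
            (s≤s (s≤s z≤n))
            (build-decomposes′ f lo 1 (s≤s z≤n) (≤-trans (s≤s z≤n) len≤f)
              ∷ build-decomposes′ f (suc lo) (suc k) (s≤s z≤n) len≤f ∷ [])
      where L = suc (suc k)
    ... | false =
      split (subst (Tiling lo L) (sym (map-ival-build f (classes lo L))) (classes-tiling lo k))
            (subst (2 ≤_) (sym (length-map _ (classes lo L))) (nonModule⇒2≤classes lo k isMod))
            (All.map⁺ (All.map (λ {p} (1≤l , l<L) →
                                  build-decomposes′ f (proj₁ p) (proj₂ p) 1≤l (≤-pred (≤-trans l<L (s≤s len≤f))))
                               (tiling-proper-pieces (classes-tiling lo k) (nonModule⇒2≤classes lo k isMod))))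
      where L = suc (suc k)

    build-decomposes′ : ∀ f lo len → 1 ≤ len → len ≤ f →
                        Decomposes (proj₁ (ival (build f lo len))) (proj₂ (ival (build f lo len))) (build f lo len)
    build-decomposes′ f lo len 1≤len len≤f rewrite ival-build f lo len = build-decomposes f lo len 1≤len len≤f
module Accounting (G : OGraph) where
  open Decomp G
  open NodeQuotient G

  innerEdges : Tree → ℕ
  innerEdges c = pairSum ⟪ adj G ⟫ (segmentOf (ival c))

  block : ℕ → Tree × Label → List QV
  block j p = map (λ g → j , proj₂ p , ival g) (children (proj₁ p))

  quotientVerticesOf : List ℕ → List Tree → List Label → List QV
  quotientVerticesOf js cs ls = concat (zipWith block js (zipWith _,_ cs ls))

  quotientAdj≤crossSum : ∀ a b → ⟦ quotientAdj a b ⟧ ≤ crossSum ⟪ adj G ⟫ (segmentOf (qiv a)) (segmentOf (qiv b))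
  quotientAdj≤crossSum (_ , _ , (a , la)) (_ , _ , (b , lb)) rewrite range≡segment a la | range≡segment b lb =
    ≤-trans (⟦∧⟧-≤ʳ _ _)
      (≤-trans (⟦any⟧≤∑ _ (segment a la)) (∑-mono (segment a la) (λ u → ⟦any⟧≤∑ (adj G u) (segment b lb))))

  block-vertices : ∀ j p → concatMap (segmentOf ∘ qiv) (block j p) ≡ grandchildVertices (proj₁ p)
  block-vertices j (c , l) = cong concat (sym (map-∘ (children c)))

  block-edgeless : ∀ j p → pairSum ⟪ quotientAdj ⟫ (block j p) ≡ 0
  block-edgeless j (c , l) =
    trans (pairSum-map ⟪ quotientAdj ⟫ (λ g → j , l , ival g) (children c))
          (pairSum-zero _ (λ a b → cong (λ t → ⟦ not t ∧ edgeBetween (ival a) (ival b) ⟧) (≡ᵇ-refl j)) (children c))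

  quotientVertices-⊆ : ∀ js cs ls → concatMap (segmentOf ∘ qiv) (quotientVerticesOf js cs ls) ⊆ concatMap grandchildVertices cs
  quotientVertices-⊆ [] cs ls = minimum _
  quotientVertices-⊆ (j ∷ js) [] ls = []
  quotientVertices-⊆ (j ∷ js) (c ∷ cs) [] = minimum _
  quotientVertices-⊆ (j ∷ js) (c ∷ cs) (l ∷ ls) =
    subst (_⊆ grandchildVertices c ++ concatMap grandchildVertices cs)
          (sym (trans (concatMap-++ (segmentOf ∘ qiv) (block j (c , l)) (quotientVerticesOf js cs ls))
                      (cong (_++ _) (block-vertices j (c , l)))))
          (++⁺ ⊆-refl (quotientVertices-⊆ js cs ls))

  length-quotientVertices : ∀ js cs ls → length (quotientVerticesOf js cs ls) ≤ ∑ (length ∘ children) cs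
  length-quotientVertices [] cs ls = z≤n
  length-quotientVertices (j ∷ js) [] ls = z≤n
  length-quotientVertices (j ∷ js) (c ∷ cs) [] = z≤n
  length-quotientVertices (j ∷ js) (c ∷ cs) (l ∷ ls) =
    subst (_≤ length (children c) + ∑ (length ∘ children) cs)
          (sym (trans (length-++ (block j (c , l))) (cong (_+ length (quotientVerticesOf js cs ls)) (length-map _ (children c)))))
          (+-monoʳ-≤ (length (children c)) (length-quotientVertices js cs ls))

  ∑innerEdges≤ : ∀ cs → ∑ innerEdges cs ≤ pairSum ⟪ adj G ⟫ (concatMap (segmentOf ∘ ival) cs)
  ∑innerEdges≤ cs = subst (_≤ pairSum ⟪ adj G ⟫ (concatMap (segmentOf ∘ ival) cs))
                          (∑-map (pairSum ⟪ adj G ⟫) (segmentOf ∘ ival) cs)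
                          (pairSum-concat ⟪ adj G ⟫ (map (segmentOf ∘ ival) cs))

  -- An edge of the quotient graph is witnessed by an edge of G between two different children,
  -- and distinct quotient edges give distinct witnesses.
  quotient+inner≤ : ∀ js cs ls → All (λ c → grandchildVertices c ≡ segmentOf (ival c)) cs →
    pairSum ⟪ quotientAdj ⟫ (quotientVerticesOf js cs ls) + ∑ innerEdges cs
      ≤ pairSum ⟪ adj G ⟫ (concatMap (segmentOf ∘ ival) cs)
  quotient+inner≤ [] cs ls _ = ∑innerEdges≤ cs
  quotient+inner≤ (j ∷ js) [] ls _ = z≤n
  quotient+inner≤ (j ∷ js) (c ∷ cs) [] _ = ∑innerEdges≤ (c ∷ cs)
  quotient+inner≤ (j ∷ js) (c ∷ cs) (l ∷ ls) (c-tiled ∷ cs-tiled) = begin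
      pairSum Q (B ++ V) + (innerEdges c + ∑ innerEdges cs)
    ≡⟨ cong (_+ (innerEdges c + ∑ innerEdges cs)) (pairSum-++ Q B V) ⟩
      pairSum Q B + pairSum Q V + crossSum Q B V + (innerEdges c + ∑ innerEdges cs)
    ≡⟨ cong (λ z → z + pairSum Q V + crossSum Q B V + (innerEdges c + ∑ innerEdges cs)) (block-edgeless j (c , l)) ⟩
      pairSum Q V + crossSum Q B V + (innerEdges c + ∑ innerEdges cs)
    ≡⟨ regroup (pairSum Q V) (crossSum Q B V) (innerEdges c) (∑ innerEdges cs) ⟩
      innerEdges c + (pairSum Q V + ∑ innerEdges cs) + crossSum Q B V
    ≤⟨ +-mono-≤ (+-monoʳ-≤ (innerEdges c) (quotient+inner≤ js cs ls cs-tiled)) cross≤ ⟩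
      pairSum A (segmentOf (ival c)) + pairSum A Us + crossSum A (segmentOf (ival c)) Us
    ≡⟨ sym (pairSum-++ A (segmentOf (ival c)) Us) ⟩
      pairSum A (segmentOf (ival c) ++ Us) ∎
    where
      open ≤-Reasoning
      Q = ⟪ quotientAdj ⟫
      A = ⟪ adj G ⟫
      B = block j (c , l)
      V = quotientVerticesOf js cs ls
      Us = concatMap (segmentOf ∘ ival) cs
      regroup : ∀ b x a s → b + x + (a + s) ≡ a + (b + s) + x
      regroup = solve-∀
      grandchildren≡ : concatMap grandchildVertices cs ≡ Us
      grandchildren≡ = cong concat (map-cong-local cs-tiled)
      cross≤ : crossSum Q B V ≤ crossSum A (segmentOf (ival c)) Us
      cross≤ = ≤-trans (crossSum-concatMap Q A (segmentOf ∘ qiv) quotientAdj≤crossSum B V)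
                 (crossSum-⊆ A (⊆-reflexive (trans (block-vertices j (c , l)) c-tiled))
                               (subst (concatMap (segmentOf ∘ qiv) V ⊆_) grandchildren≡ (quotientVertices-⊆ js cs ls)))

-- Budget N k len e Hs bounds the graphs Hs produced by k disjoint subtrees covering len vertices
-- and e edges of G.  The slack k is what lets a split node, having at least two children,
-- pay for the at most 1 + 2 e(G_x) refined quotient graphs it contributes itself.
record Budget (N k len e : ℕ) (Hs : List OGraph) : Set where
  field
    edges-≤ : ∑ edges Hs ≤ e
    length-≤ : length Hs + k ≤ 3 * len + 2 * e
    sizes-≤ : All (λ H → size H ≤ N) Hs

sizes-weaken : ∀ {N N' Hs} → N ≤ N' → All (λ H → size H ≤ N) Hs → All (λ H → size H ≤ N') Hs
sizes-weaken N≤N' = All.map (λ s≤N → ≤-trans s≤N N≤N')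

budget-++ : ∀ {N k len e Hs k' len' e' Hs'} → Budget N k len e Hs → Budget N k' len' e' Hs' →
            Budget N (k + k') (len + len') (e + e') (Hs ++ Hs')
budget-++ {N} {k} {len} {e} {Hs} {k'} {len'} {e'} {Hs'} b b' = record
  { edges-≤ = subst (_≤ e + e') (sym (∑-++ edges Hs Hs')) (+-mono-≤ (edges-≤ b) (edges-≤ b'))
  ; length-≤ = begin
      length (Hs ++ Hs') + (k + k')            ≡⟨ cong (_+ (k + k')) (length-++ Hs) ⟩
      length Hs + length Hs' + (k + k')        ≡⟨ regroup (length Hs) (length Hs') k k' ⟩
      (length Hs + k) + (length Hs' + k')      ≤⟨ +-mono-≤ (length-≤ b) (length-≤ b') ⟩
      (3 * len + 2 * e) + (3 * len' + 2 * e')  ≡⟨ distribute len e len' e' ⟩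
      3 * (len + len') + 2 * (e + e')          ∎
  ; sizes-≤ = All.++⁺ (sizes-≤ b) (sizes-≤ b')
  }
  where
    open Budget
    open ≤-Reasoning
    regroup : ∀ a b c d → a + b + (c + d) ≡ (a + c) + (b + d)
    regroup = solve-∀
    distribute : ∀ a b c d → (3 * a + 2 * b) + (3 * c + 2 * d) ≡ 3 * (a + c) + 2 * (b + d)
    distribute = solve-∀

budget-node : ∀ {len ex eKids e k Hs Hs'} →
              ∑ edges Hs ≤ ex → length Hs ≤ 1 + 2 * ex → All (λ H → size H ≤ len) Hs →
              Budget len k len eKids Hs' → 2 ≤ k → ex + eKids ≤ e → Budget len 1 len e (Hs ++ Hs')
budget-node {len} {ex} {eKids} {e} {k} {Hs} {Hs'} Hs-edges Hs-length Hs-sizes b 2≤k ex+eKids≤e = record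
  { edges-≤ = subst (_≤ e) (sym (∑-++ edges Hs Hs')) (≤-trans (+-mono-≤ Hs-edges (edges-≤ b)) ex+eKids≤e)
  ; length-≤ = begin
      length (Hs ++ Hs') + 1          ≡⟨ cong (_+ 1) (length-++ Hs) ⟩
      length Hs + length Hs' + 1      ≤⟨ +-monoˡ-≤ 1 (+-monoˡ-≤ (length Hs') Hs-length) ⟩
      1 + 2 * ex + length Hs' + 1     ≡⟨ regroup ex (length Hs') ⟩
      2 * ex + (length Hs' + 2)       ≤⟨ +-monoʳ-≤ (2 * ex) (+-monoʳ-≤ (length Hs') 2≤k) ⟩
      2 * ex + (length Hs' + k)       ≤⟨ +-monoʳ-≤ (2 * ex) (length-≤ b) ⟩
      2 * ex + (3 * len + 2 * eKids)  ≡⟨ distribute ex len eKids ⟩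
      3 * len + 2 * (ex + eKids)      ≤⟨ +-monoʳ-≤ (3 * len) (*-monoʳ-≤ 2 ex+eKids≤e) ⟩
      3 * len + 2 * e                 ∎
  ; sizes-≤ = All.++⁺ Hs-sizes (sizes-≤ b)
  }
  where
    open Budget
    open ≤-Reasoning
    regroup : ∀ a b → 1 + 2 * a + b + 1 ≡ 2 * a + (b + 2)
    regroup = solve-∀
    distribute : ∀ a b c → 2 * a + (3 * b + 2 * c) ≡ 3 * b + 2 * (a + c)
    distribute = solve-∀

module TreeBudget (G : OGraph) where
  open Decomp G
  open Refined G
  open NodeQuotient G
  open Accounting G

  DecomposesIval : Tree → Set
  DecomposesIval c = Decomposes (proj₁ (ival c)) (proj₂ (ival c)) c

  mutual
    subtree-budget : ∀ {lo len x} → Decomposes lo len x → ∀ ctx →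
                     Budget len 1 len (pairSum ⟪ adj G ⟫ (segment lo len)) (allRefined ctx x)
    subtree-budget (singleton lo) ctx = record { edges-≤ = z≤n ; length-≤ = ≤-refl ; sizes-≤ = z≤n ∷ z≤n ∷ [] }
    subtree-budget (split {lo} {len} {cs} T 2≤cs ds) ctx =
      budget-node (refined-edges mb vs l₀) (refined-length vs l₀) (sizes-weaken |vs|≤len (refined-sizes mb vs l₀))
                  kids 2≤cs quotient+kids≤
      where
        ls = refine (map (baseLabel ctx) cs)
        l₀ = at ∅ ls 0
        vs = quotientVerticesOf (upTo (length cs)) cs ls
        mb = isMB (quotientGraph vs)
        pieces = All.map⁻ (tiling-pieces T)
        lengths≡ : ∑ (proj₂ ∘ ival) cs ≡ len
        lengths≡ = trans (sym (∑-map proj₂ ival cs)) (tiling-lengths T)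
        kids : Budget len (length cs) len (∑ innerEdges cs) (goCs cs 0 cs)
        kids = subst (λ l → Budget len (length cs) l (∑ innerEdges cs) (goCs cs 0 cs)) lengths≡
                     (children-budget cs 0 ds len (All.map proj₂ pieces))
        quotient+kids≤ : edges (quotientGraph vs) + ∑ innerEdges cs ≤ pairSum ⟪ adj G ⟫ (segment lo len)
        quotient+kids≤ =
          subst₂ (λ a b → a + ∑ innerEdges cs ≤ pairSum ⟪ adj G ⟫ b)
                 (sym (edges-mkGraph dQV vs quotientAdj)) (trans (cong concat (map-∘ cs)) (tiling-segments T))
                 (quotient+inner≤ (upTo (length cs)) cs ls (All.map decomposes-grandchildVertices ds))
        |vs|≤len : length vs ≤ len
        |vs|≤len = ≤-trans (length-quotientVertices (upTo (length cs)) cs ls)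
                           (subst (∑ (length ∘ children) cs ≤_) lengths≡ (∑-mono-All (All.map decomposes-children ds)))

    children-budget : ∀ cs' i {cs} → All DecomposesIval cs → (N : ℕ) → All (λ c → proj₂ (ival c) ≤ N) cs →
                      Budget N (length cs) (∑ (proj₂ ∘ ival) cs) (∑ innerEdges cs) (goCs cs' i cs)
    children-budget cs' i [] N [] = record { edges-≤ = z≤n ; length-≤ = z≤n ; sizes-≤ = [] }
    children-budget cs' i {c ∷ cs} (d ∷ ds) N (len≤N ∷ lens≤N) =
      budget-++ first (children-budget cs' (suc i) ds N lens≤N)
      where
        ctx = just (cousinIntervals cs' i)
        b = subtree-budget d ctx
        first : Budget N 1 (proj₂ (ival c)) (innerEdges c) (allRefined ctx c)
        first = record { edges-≤ = Budget.edges-≤ b ; length-≤ = Budget.length-≤ b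
                      ; sizes-≤ = sizes-weaken len≤N (Budget.sizes-≤ b) }

3n+2m≤4mn : ∀ m n → 2 ≤ m → 1 ≤ n → 3 * n + 2 * m ≤ 4 * m * n
3n+2m≤4mn (suc zero) _ (s≤s ()) _
3n+2m≤4mn (suc (suc m)) (suc n) _ _ = subst (3 * suc n + 2 * suc (suc m) ≤_) (sym (expand m n)) (m≤m+n _ _)
  where
    expand : ∀ m n → 4 * suc (suc m) * suc n ≡ (3 * suc n + 2 * suc (suc m)) + (1 + 5 * n + 2 * m + 4 * m * n)
    expand = solve-∀

1≤edges⇒1≤size : (H : OGraph) → 1 ≤ edges H → 1 ≤ size H
1≤edges⇒1≤size H 1≤e with size H in n≡0 | edges≡pairSum H
... | suc _ | _ = s≤s z≤n
... | zero | e≡0 = ⊥-elim (<⇒≱ 1≤e (≤-reflexive e≡0))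

record RefinementBound (H : OGraph) (Hs : List OGraph) : Set where
  field
    edges-≤ : ∑ edges Hs ≤ edges H
    length-≤ : length Hs ≤ 4 * edges H * size H
    sizes-≤ : All (λ H' → size H' ≤ size H) Hs

refinedQuotients-bound : (H : OGraph) → RefinementBound H (Refined.refinedQuotients H)
refinedQuotients-bound H = bound (isMB H) refl
  where
    open Refined H
    open TreeBudget H
    open DecompositionShape H
    n = size H
    edges≡ : pairSum ⟪ adj H ⟫ (segment 0 n) ≡ edges H
    edges≡ = trans (pairSum-adj H 0 n) (sym (edges≡pairSum H))
    bound : ∀ b → isMB H ≡ b → RefinementBound H (if b then [] else allRefined nothing (Decomp.tree H))
    bound true _ = record { edges-≤ = z≤n ; length-≤ = z≤n ; sizes-≤ = [] }
    bound false notMB = record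
      { edges-≤ = subst (∑ edges Hs ≤_) edges≡ (Budget.edges-≤ b)
      ; length-≤ = ≤-trans (m≤m+n _ 1)
                     (≤-trans (subst (λ e → length Hs + 1 ≤ 3 * n + 2 * e) edges≡ (Budget.length-≤ b))
                              (3n+2m≤4mn (edges H) n 2≤m 1≤n))
      ; sizes-≤ = Budget.sizes-≤ b
      }
      where
        2≤m = nonMB⇒2≤edges H notMB
        1≤n = 1≤edges⇒1≤size H (≤-trans (n≤1+n 1) 2≤m)
        Hs = allRefined nothing (Decomp.tree H)
        b = subtree-budget (build-decomposes n 0 n 1≤n ≤-refl) nothing

refineAll : List OGraph → List OGraph
refineAll = concatMap Refined.refinedQuotients

refineAll-edges : (Hs : List OGraph) → ∑ edges (refineAll Hs) ≤ ∑ edges Hs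
refineAll-edges Hs =
  subst (_≤ ∑ edges Hs) (sym (trans (∑-concat edges (map RQ Hs)) (∑-map (∑ edges) RQ Hs)))
        (∑-mono Hs (RefinementBound.edges-≤ ∘ refinedQuotients-bound))
  where RQ = Refined.refinedQuotients

module _ (N : ℕ) (Hs : List OGraph) (small : All (λ H → size H ≤ N) Hs) where
  private
    RQ : OGraph → List OGraph
    RQ = Refined.refinedQuotients

  refineAll-sizes : All (λ H → size H ≤ N) (refineAll Hs)
  refineAll-sizes = All.concat⁺ (All.map⁺ (All.map (λ {H} size≤N →
                      sizes-weaken size≤N (RefinementBound.sizes-≤ (refinedQuotients-bound H))) small))

  refineAll-length : length (refineAll Hs) ≤ 4 * ∑ edges Hs * N
  refineAll-length = begin
      length (refineAll Hs)                 ≡⟨ trans (length-concat (map RQ Hs)) (∑-map length RQ Hs) ⟩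
      ∑ (length ∘ RQ) Hs                    ≤⟨ ∑-mono-All (All.map (λ {H} → per-graph H) small) ⟩
      ∑ (λ H → (4 * N) * edges H) Hs        ≡⟨ ∑-*ˡ (4 * N) edges Hs ⟩
      (4 * N) * ∑ edges Hs                  ≡⟨ reorder N (∑ edges Hs) ⟩
      4 * ∑ edges Hs * N                    ∎
    where
      open ≤-Reasoning
      reorder : ∀ a b → (4 * a) * b ≡ 4 * b * a
      reorder = solve-∀
      per-graph : ∀ H → size H ≤ N → length (RQ H) ≤ (4 * N) * edges H
      per-graph H size≤N = ≤-trans (RefinementBound.length-≤ (refinedQuotients-bound H))
        (subst (4 * edges H * size H ≤_) (reorder (edges H) N) (*-monoʳ-≤ (4 * edges H) size≤N))

𝒢-invariant : (G : OGraph) (i : ℕ) → ∑ edges (𝒢 i G) ≤ edges G × All (λ H → size H ≤ size G) (𝒢 i G)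
𝒢-invariant G zero = ≤-reflexive (+-identityʳ (edges G)) , ≤-refl ∷ []
𝒢-invariant G (suc i) with 𝒢-invariant G i
... | edges≤ , small = ≤-trans (refineAll-edges (𝒢 i G)) edges≤ , refineAll-sizes _ _ small

lemma18 : (G : OGraph) (r : ℕ) → 1 ≤ r →
    sum (map edges (𝒢 r G)) ≤ edges G × length (𝒢 r G) ≤ 4 * edges G * size G
lemma18 G (suc i) _ with 𝒢-invariant G i
... | edges≤ , small =
  ≤-trans (refineAll-edges (𝒢 i G)) edges≤ ,
  ≤-trans (refineAll-length _ _ small) (*-monoˡ-≤ (size G) (*-monoʳ-≤ 4 edges≤))
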